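{- Let $n \ge 0$, let $a,b$ be integers not both even, let $u \in \{\pm 1, \pm i\}$, and let $x,y$ be integers that are both even. If $x+yi \in Oct_n + u(a+bi)$, then $x+yi \in B_n + u(a+bi)$.
   Context: For $n\ge 0$, $B_n = \left\{ \sum_{j=0}^n v_j (1+i)^j : v_j \in \{0,\pm 1,\pm i\}\right\} \subset \mathbb{Z}[i]$. The sequence $(w_k)_{k\ge0}$ is defined by $w_{2m} = 2^{m+1}+2^m$ and $w_{2m+1} = 2^{m+2}$. The $n$-th octagon is $Oct_n = \{x+yi \in \mathbb{Z}[i] : |x|,|y| \le w_n - 2,\ |x|+|y| \le w_{n+1}-3\}$. For a set $X$ and $w\in\mathbb{Z}[i]$, $X+w = \{x+w: x\in X\}$. -}

module Defs where

open import Data.Nat as ℕ using (ℕ; zero; suc)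
open import Data.Integer as ℤ using (ℤ; +_; _-_; _*_; _+_; -_; ∣_∣)
open import Data.Product using (_×_; _,_; ∃)
open import Data.Vec using (Vec; []; _∷_)
open import Relation.Binary.PropositionalEquality using (_≡_)

ℤ[i] : Set
ℤ[i] = ℤ × ℤ

re : ℤ[i] → ℤ
re (x , _) = x

im : ℤ[i] → ℤ
im (_ , y) = y

_+ᵍ_ : ℤ[i] → ℤ[i] → ℤ[i]
(a , b) +ᵍ (c , d) = (a + c , b + d)

_-ᵍ_ : ℤ[i] → ℤ[i] → ℤ[i]
(a , b) -ᵍ (c , d) = (a - c , b - d)

_*ᵍ_ : ℤ[i] → ℤ[i] → ℤ[i]
(a , b) *ᵍ (c , d) = (a * c - b * d , a * d + b * c)

0ᵍ : ℤ[i]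
0ᵍ = (+ 0 , + 0)

1ᵍ : ℤ[i]
1ᵍ = (+ 1 , + 0)

ρ : ℤ[i]
ρ = (+ 1 , + 1)

_^ᵍ_ : ℤ[i] → ℕ → ℤ[i]
z ^ᵍ zero = 1ᵍ
z ^ᵍ suc n = z *ᵍ (z ^ᵍ n)

data Unit : Set where
  u1 um1 ui umi : Unit

unitVal : Unit → ℤ[i]
unitVal u1  = (+ 1 , + 0)
unitVal um1 = (- + 1 , + 0)
unitVal ui  = (+ 0 , + 1)
unitVal umi = (+ 0 , - + 1)

data Digit : Set where
  d0 : Digit
  dU : Unit → Digit

digitVal : Digit → ℤ[i]
digitVal d0     = 0ᵍ
digitVal (dU u) = unitVal u

digitSum : ∀ {k} → ℕ → Vec Digit k → ℤ[i]
digitSum j []       = 0ᵍ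
digitSum j (v ∷ vs) = (digitVal v *ᵍ (ρ ^ᵍ j)) +ᵍ digitSum (suc j) vs

InB : ℕ → ℤ[i] → Set
InB n z = ∃ λ (v : Vec Digit (suc n)) → digitSum 0 v ≡ z

-- w_{2m} = 2^{m+1} + 2^m, w_{2m+1} = 2^{m+2}
w : ℕ → ℕ
w k with k ℕ.% 2
... | 0 = 2 ℕ.^ (suc (k ℕ./ 2)) ℕ.+ 2 ℕ.^ (k ℕ./ 2)
... | _ = 2 ℕ.^ (2 ℕ.+ k ℕ./ 2)

InOct : ℕ → ℤ[i] → Set
InOct n (x , y) =
  (+ ∣ x ∣ ℤ.≤ + w n - + 2) × (+ ∣ y ∣ ℤ.≤ + w n - + 2)
  × (+ ∣ x ∣ + + ∣ y ∣ ℤ.≤ + w (suc n) - + 3)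

_∈_+shift_ : ℤ[i] → (ℤ[i] → Set) → ℤ[i] → Set
z ∈ X +shift t = X (z -ᵍ t)

-- Write z = d + ρ z′ with ρ = 1 + i and a digit d ∈ {0, ±1, ±i}: if both coordinates of z are
-- odd take d = 0, otherwise let d = ±1 or ±i move the even coordinate one step towards 0.
-- Then z − d = (p , q) has both coordinates odd and z′ = ((p + q)/2 , (q − p)/2), so that
-- 2|Re z′|, 2|Im z′| ≤ |p| + |q| and |Re z′| + |Im z′| = max (|p|, |q|): division by ρ exchanges
-- the ℓ∞ and ℓ¹ constraints of the octagon. As w_{n+2} = 2 w_n and w_{n+1} = 2 h_n with
-- 2 ≤ h_n < w_n, rounding by parity sends Oct_{n+1} into Oct_n, and z′ is again not in 2ℤ[i]
-- (its coordinates differ by the odd p). Induction on n, with Oct_0 ∖ 2ℤ[i] = {±1, ±i}, shows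
-- that every point of Oct_n outside 2ℤ[i] lies in B_n; the point (x + yi) − u(a + bi) is one.

module Submission where

open import Defs
open import Data.Nat using (ℕ; zero; suc; z≤n; s≤s)
open import Data.Integer using (ℤ; +_; -[1+_]; +[1+_]; ∣_∣)
open import Data.Integer.Divisibility using (_∣_)
open import Data.Product using (_×_; _,_; ∃; ∃₂)
open import Relation.Nullary using (¬_; yes; no)

import Data.Integer as ℤ
import Data.Integer.Properties as ℤ
import Data.Integer.DivMod as ℤ
import Data.Integer.Divisibility.Signed as ℤ
import Data.Nat as ℕ
import Data.Nat.Properties as ℕ
import Data.Nat.Divisibility as ℕ
open import Data.Empty using (⊥-elim)
open import Data.Sum using (_⊎_; inj₁; inj₂)
open import Relation.Binary.PropositionalEquality

Odd : ℤ → Set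
Odd x = ¬ (+ 2 ∣ x)

BothEven : ℤ[i] → Set
BothEven (x , y) = (+ 2 ∣ x) × (+ 2 ∣ y)

-- The integer operators are opened only inside this block; below it they are those of ℕ.
module _ where
  open import Data.Integer using (_+_; _-_; _*_; -_; _≤_)
  open import Data.Integer.Tactic.RingSolver using (solve; solve-∀)
  open import Data.List using (_∷_; [])

  *ᵍ-comm : ∀ u v → u *ᵍ v ≡ v *ᵍ u
  *ᵍ-comm (a , b) (c , d) =
    cong₂ _,_ (solve (a ∷ b ∷ c ∷ d ∷ [])) (solve (a ∷ b ∷ c ∷ d ∷ []))

  *ᵍ-assoc : ∀ u v z → (u *ᵍ v) *ᵍ z ≡ u *ᵍ (v *ᵍ z)
  *ᵍ-assoc (a , b) (c , d) (e , f) = cong₂ _,_ real imag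
    where
    real : (a * c - b * d) * e - (a * d + b * c) * f ≡ a * (c * e - d * f) - b * (c * f + d * e)
    real = solve (a ∷ b ∷ c ∷ d ∷ e ∷ f ∷ [])
    imag : (a * c - b * d) * f + (a * d + b * c) * e ≡ a * (c * f + d * e) + b * (c * e - d * f)
    imag = solve (a ∷ b ∷ c ∷ d ∷ e ∷ f ∷ [])

  *ᵍ-leftComm : ∀ u v z → u *ᵍ (v *ᵍ z) ≡ v *ᵍ (u *ᵍ z)
  *ᵍ-leftComm u v z = begin
    u *ᵍ (v *ᵍ z)  ≡⟨ *ᵍ-assoc u v z ⟨
    (u *ᵍ v) *ᵍ z  ≡⟨ cong (_*ᵍ z) (*ᵍ-comm u v) ⟩
    (v *ᵍ u) *ᵍ z  ≡⟨ *ᵍ-assoc v u z ⟩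
    v *ᵍ (u *ᵍ z)  ∎
    where open ≡-Reasoning

  *ᵍ-identityˡ : ∀ z → 1ᵍ *ᵍ z ≡ z
  *ᵍ-identityˡ (a , b) = cong₂ _,_ (solve (a ∷ b ∷ [])) (solve (a ∷ b ∷ []))

  *ᵍ-identityʳ : ∀ z → z *ᵍ 1ᵍ ≡ z
  *ᵍ-identityʳ (a , b) = cong₂ _,_ (solve (a ∷ b ∷ [])) (solve (a ∷ b ∷ []))

  *ᵍ-distribˡ-+ᵍ : ∀ u v z → u *ᵍ (v +ᵍ z) ≡ (u *ᵍ v) +ᵍ (u *ᵍ z)
  *ᵍ-distribˡ-+ᵍ (a , b) (c , d) (e , f) = cong₂ _,_ real imag
    where
    real : a * (c + e) - b * (d + f) ≡ (a * c - b * d) + (a * e - b * f)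
    real = solve (a ∷ b ∷ c ∷ d ∷ e ∷ f ∷ [])
    imag : a * (d + f) + b * (c + e) ≡ (a * d + b * c) + (a * f + b * e)
    imag = solve (a ∷ b ∷ c ∷ d ∷ e ∷ f ∷ [])

  x≡y+ᵍ[x-ᵍy] : ∀ x y → x ≡ y +ᵍ (x -ᵍ y)
  x≡y+ᵍ[x-ᵍy] (a , b) (c , d) = cong₂ _,_ (i≡j+[i-j] a c) (i≡j+[i-j] b d)
    where
    i≡j+[i-j] : ∀ i j → i ≡ j + (i - j)
    i≡j+[i-j] = solve-∀

  x-ᵍ[x-ᵍy]≡y : ∀ x y → x -ᵍ (x -ᵍ y) ≡ y
  x-ᵍ[x-ᵍy]≡y (a , b) (c , d) = cong₂ _,_ (i-[i-j]≡j a c) (i-[i-j]≡j b d)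
    where
    i-[i-j]≡j : ∀ i j → i - (i - j) ≡ j
    i-[i-j]≡j = solve-∀

  ρ*ᵍ[a,b]≡[a-b,a+b] : ∀ a b → ρ *ᵍ (a , b) ≡ (a - b , a + b)
  ρ*ᵍ[a,b]≡[a-b,a+b] a b = cong₂ _,_ (solve (a ∷ b ∷ [])) (solve (a ∷ b ∷ []))

  odd-1 : Odd (+ 1)
  odd-1 2∣1 with ℕ.∣1⇒≡1 2∣1
  ... | ()

  -- The statement's ∣ divides absolute values; sums and products go through signed ∣.
  2∣⇒2∣ˢ : ∀ {x} → + 2 ∣ x → + 2 ℤ.∣ x
  2∣⇒2∣ˢ {x} = ℤ.∣ᵤ⇒∣ {+ 2} {x}

  2∣ˢ⇒2∣ : ∀ {x} → + 2 ℤ.∣ x → + 2 ∣ x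
  2∣ˢ⇒2∣ {x} = ℤ.∣⇒∣ᵤ {+ 2} {x}

  2∣k*2 : ∀ k → + 2 ∣ k * + 2
  2∣k*2 k = 2∣ˢ⇒2∣ (ℤ.divides k refl)

  even+odd : ∀ {x y} → + 2 ∣ x → Odd y → Odd (x + y)
  even+odd {x} {y} 2∣x y-odd 2∣x+y =
    y-odd (2∣ˢ⇒2∣ {y} (ℤ.∣m+n∣m⇒∣n (2∣⇒2∣ˢ {x + y} 2∣x+y) (2∣⇒2∣ˢ {x} 2∣x)))

  even-or-odd : ∀ x → (∃ λ k → x ≡ k * + 2) ⊎ (∃ λ k → x ≡ + 1 + k * + 2)
  even-or-odd x with x ℤ.%ℕ 2 | ℤ.n%ℕd<d x 2 | ℤ.a≡a%ℕn+[a/ℕn]*n x 2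
  ... | 0 | _ | x≡ = inj₁ (x ℤ./ℕ 2 , trans x≡ (ℤ.+-identityˡ _))
  ... | 1 | _ | x≡ = inj₂ (x ℤ./ℕ 2 , x≡)
  ... | suc (suc _) | s≤s (s≤s ()) | _

  odd-halves : ∀ {p q} → Odd p → Odd q → ∃₂ λ a b → a - b ≡ p × a + b ≡ q
  odd-halves {p} {q} p-odd q-odd with even-or-odd p | even-or-odd q
  ... | inj₁ (k , refl) | _               = ⊥-elim (p-odd (2∣k*2 k))
  ... | inj₂ _          | inj₁ (k , refl) = ⊥-elim (q-odd (2∣k*2 k))
  ... | inj₂ (s , refl) | inj₂ (t , refl) = + 1 + s + t , t - s , difference , sum
    where
    difference : (+ 1 + s + t) - (t - s) ≡ + 1 + s * + 2
    difference = solve (s ∷ t ∷ [])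
    sum : (+ 1 + s + t) + (t - s) ≡ + 1 + t * + 2
    sum = solve (s ∷ t ∷ [])

  odd-difference⇒¬BothEven : ∀ {a b} → Odd (a - b) → ¬ BothEven (a , b)
  odd-difference⇒¬BothEven {a} {b} a-b-odd (2∣a , 2∣b) =
    a-b-odd (2∣ˢ⇒2∣ (ℤ.∣m∣n⇒∣m-n (2∣⇒2∣ˢ {a} 2∣a) (2∣⇒2∣ˢ {b} 2∣b)))

  BothEven-*ᵍ : ∀ u z → BothEven z → BothEven (u *ᵍ z)
  BothEven-*ᵍ (c , d) (a , b) (2∣a , 2∣b) =
    2∣ˢ⇒2∣ (ℤ.∣m∣n⇒∣m-n (ℤ.∣n⇒∣m*n c 2∣a′) (ℤ.∣n⇒∣m*n d 2∣b′)) ,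
    2∣ˢ⇒2∣ (ℤ.∣m∣n⇒∣m+n (ℤ.∣n⇒∣m*n c 2∣b′) (ℤ.∣n⇒∣m*n d 2∣a′))
    where
    2∣a′ : + 2 ℤ.∣ a
    2∣a′ = 2∣⇒2∣ˢ {a} 2∣a
    2∣b′ : + 2 ℤ.∣ b
    2∣b′ = 2∣⇒2∣ˢ {b} 2∣b

  BothEven--ᵍ : ∀ z w → BothEven z → BothEven w → BothEven (z -ᵍ w)
  BothEven--ᵍ (a , b) (c , d) (2∣a , 2∣b) (2∣c , 2∣d) =
    2∣ˢ⇒2∣ (ℤ.∣m∣n⇒∣m-n (2∣⇒2∣ˢ {a} 2∣a) (2∣⇒2∣ˢ {c} 2∣c)) ,
    2∣ˢ⇒2∣ (ℤ.∣m∣n⇒∣m-n (2∣⇒2∣ˢ {b} 2∣b) (2∣⇒2∣ˢ {d} 2∣d))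

  ∣i∣+∣j∣≡∣i-j∣⊎∣i∣+∣j∣≡∣i+j∣ : ∀ i j →
    ∣ i ∣ ℕ.+ ∣ j ∣ ≡ ∣ i - j ∣ ⊎ ∣ i ∣ ℕ.+ ∣ j ∣ ≡ ∣ i + j ∣
  ∣i∣+∣j∣≡∣i-j∣⊎∣i∣+∣j∣≡∣i+j∣ (+ m)    (+ n)     = inj₂ refl
  ∣i∣+∣j∣≡∣i-j∣⊎∣i∣+∣j∣≡∣i+j∣ (+ m)    -[1+ n ]  = inj₁ refl
  ∣i∣+∣j∣≡∣i-j∣⊎∣i∣+∣j∣≡∣i+j∣ -[1+ m ] (+ zero)  = inj₁ (ℕ.+-identityʳ (suc m))
  ∣i∣+∣j∣≡∣i-j∣⊎∣i∣+∣j∣≡∣i+j∣ -[1+ m ] +[1+ n ]  = inj₁ (cong suc (ℕ.+-suc m n))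
  ∣i∣+∣j∣≡∣i-j∣⊎∣i∣+∣j∣≡∣i+j∣ -[1+ m ] -[1+ n ]  = inj₂ (cong suc (ℕ.+-suc m n))

  2∣i∣≤∣i-j∣+∣i+j∣ : ∀ i j → 2 ℕ.* ∣ i ∣ ℕ.≤ ∣ i - j ∣ ℕ.+ ∣ i + j ∣
  2∣i∣≤∣i-j∣+∣i+j∣ i j = begin
    2 ℕ.* ∣ i ∣                ≡⟨ ℤ.abs-* (+ 2) i ⟨
    ∣ + 2 * i ∣                ≡⟨ cong ∣_∣ 2i≡[i-j]+[i+j] ⟩
    ∣ (i - j) + (i + j) ∣      ≤⟨ ℤ.∣i+j∣≤∣i∣+∣j∣ (i - j) (i + j) ⟩
    ∣ i - j ∣ ℕ.+ ∣ i + j ∣    ∎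
    where
    open ℕ.≤-Reasoning
    2i≡[i-j]+[i+j] : + 2 * i ≡ (i - j) + (i + j)
    2i≡[i-j]+[i+j] = solve (i ∷ j ∷ [])

  2∣j∣≤∣i-j∣+∣i+j∣ : ∀ i j → 2 ℕ.* ∣ j ∣ ℕ.≤ ∣ i - j ∣ ℕ.+ ∣ i + j ∣
  2∣j∣≤∣i-j∣+∣i+j∣ i j = begin
    2 ℕ.* ∣ j ∣                ≡⟨ ℤ.abs-* (+ 2) j ⟨
    ∣ + 2 * j ∣                ≡⟨ cong ∣_∣ 2j≡[i+j]-[i-j] ⟩
    ∣ (i + j) - (i - j) ∣      ≤⟨ ℤ.∣i-j∣≤∣i∣+∣j∣ (i + j) (i - j) ⟩
    ∣ i + j ∣ ℕ.+ ∣ i - j ∣    ≡⟨ ℕ.+-comm ∣ i + j ∣ ∣ i - j ∣ ⟩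
    ∣ i - j ∣ ℕ.+ ∣ i + j ∣    ∎
    where
    open ℕ.≤-Reasoning
    2j≡[i+j]-[i-j] : + 2 * j ≡ (i + j) - (i - j)
    2j≡[i+j]-[i-j] = solve (i ∷ j ∷ [])

  0≤i⇒∣i-1∣≤∣i∣⊎∣i-1∣≤1 : ∀ {i} → + 0 ≤ i → ∣ i - + 1 ∣ ℕ.≤ ∣ i ∣ ⊎ ∣ i - + 1 ∣ ℕ.≤ 1
  0≤i⇒∣i-1∣≤∣i∣⊎∣i-1∣≤1 {+ zero}  _ = inj₂ ℕ.≤-refl
  0≤i⇒∣i-1∣≤∣i∣⊎∣i-1∣≤1 {+[1+ m ]} _ = inj₁ (ℕ.n≤1+n m)

  i≤0⇒∣i+1∣≤∣i∣⊎∣i+1∣≤1 : ∀ {i} → i ≤ + 0 → ∣ i + + 1 ∣ ℕ.≤ ∣ i ∣ ⊎ ∣ i + + 1 ∣ ℕ.≤ 1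
  i≤0⇒∣i+1∣≤∣i∣⊎∣i+1∣≤1 {+ zero}   _ = inj₂ ℕ.≤-refl
  i≤0⇒∣i+1∣≤∣i∣⊎∣i+1∣≤1 {+[1+ m ]} (ℤ.+≤+ ())
  i≤0⇒∣i+1∣≤∣i∣⊎∣i+1∣≤1 { -[1+ m ]} _ =
    inj₁ (ℕ.≤-trans (ℕ.≤-reflexive (ℤ.∣m⊖n∣≡∣n⊖m∣ 1 (suc m))) (ℕ.n≤1+n m))

  +i≤+j-+k⇒i+k≤j : ∀ {i j k} → + i ≤ + j - + k → i ℕ.+ k ℕ.≤ j
  +i≤+j-+k⇒i+k≤j {i} {j} {k} le =
    ℤ.drop‿+≤+ (subst (+ (i ℕ.+ k) ≤_) (x-y+y≡x (+ j) (+ k)) (ℤ.+-monoˡ-≤ (+ k) le))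
    where
    x-y+y≡x : ∀ x y → x - y + y ≡ x
    x-y+y≡x = solve-∀

  i+k≤j⇒+i≤+j-+k : ∀ {i j k} → i ℕ.+ k ℕ.≤ j → + i ≤ + j - + k
  i+k≤j⇒+i≤+j-+k {i} {j} {k} le =
    subst (_≤ + j - + k) (x+y-y≡x (+ i) (+ k)) (ℤ.+-monoˡ-≤ (- + k) (ℤ.+≤+ le))
    where
    x+y-y≡x : ∀ x y → x + y - y ≡ x
    x+y-y≡x = solve-∀

open import Data.Nat using (_+_; _*_; _^_; _≤_; _<_)
open import Data.Nat.DivMod using (m/n≡1+[m∸n]/n)
open import Data.Nat.Tactic.RingSolver using (solve-∀)
open import Data.Vec using (Vec; _∷_; [])

unit⁻¹ : Unit → Unit
unit⁻¹ u1  = u1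
unit⁻¹ um1 = um1
unit⁻¹ ui  = umi
unit⁻¹ umi = ui

unit⁻¹*ᵍunit≡1ᵍ : ∀ u → unitVal (unit⁻¹ u) *ᵍ unitVal u ≡ 1ᵍ
unit⁻¹*ᵍunit≡1ᵍ u1  = refl
unit⁻¹*ᵍunit≡1ᵍ um1 = refl
unit⁻¹*ᵍunit≡1ᵍ ui  = refl
unit⁻¹*ᵍunit≡1ᵍ umi = refl

¬BothEven-unit*ᵍ : ∀ u {z} → ¬ BothEven z → ¬ BothEven (unitVal u *ᵍ z)
¬BothEven-unit*ᵍ u {z} z-odd uz-even =
  z-odd (subst BothEven ū*ᵍ[u*ᵍz]≡z (BothEven-*ᵍ (unitVal (unit⁻¹ u)) _ uz-even))
  where
  open ≡-Reasoning
  ū*ᵍ[u*ᵍz]≡z : unitVal (unit⁻¹ u) *ᵍ (unitVal u *ᵍ z) ≡ z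
  ū*ᵍ[u*ᵍz]≡z = begin
    unitVal (unit⁻¹ u) *ᵍ (unitVal u *ᵍ z)  ≡⟨ *ᵍ-assoc (unitVal (unit⁻¹ u)) (unitVal u) z ⟨
    (unitVal (unit⁻¹ u) *ᵍ unitVal u) *ᵍ z  ≡⟨ cong (_*ᵍ z) (unit⁻¹*ᵍunit≡1ᵍ u) ⟩
    1ᵍ *ᵍ z                                 ≡⟨ *ᵍ-identityˡ z ⟩
    z                                       ∎

¬BothEven-translate : ∀ {z w} → BothEven z → ¬ BothEven w → ¬ BothEven (z -ᵍ w)
¬BothEven-translate {z} {w} z-even w-odd z-w-even =
  w-odd (subst BothEven (x-ᵍ[x-ᵍy]≡y z w) (BothEven--ᵍ z (z -ᵍ w) z-even z-w-even))

digitSum-suc : ∀ {k} j (vs : Vec Digit k) → digitSum (suc j) vs ≡ ρ *ᵍ digitSum j vs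
digitSum-suc j []       = refl
digitSum-suc j (v ∷ vs) = begin
  (digitVal v *ᵍ (ρ *ᵍ (ρ ^ᵍ j))) +ᵍ digitSum (suc (suc j)) vs
    ≡⟨ cong₂ _+ᵍ_ (*ᵍ-leftComm (digitVal v) ρ (ρ ^ᵍ j)) (digitSum-suc (suc j) vs) ⟩
  (ρ *ᵍ (digitVal v *ᵍ (ρ ^ᵍ j))) +ᵍ (ρ *ᵍ digitSum (suc j) vs)
    ≡⟨ *ᵍ-distribˡ-+ᵍ ρ (digitVal v *ᵍ (ρ ^ᵍ j)) (digitSum (suc j) vs) ⟨
  ρ *ᵍ ((digitVal v *ᵍ (ρ ^ᵍ j)) +ᵍ digitSum (suc j) vs)
    ∎
  where open ≡-Reasoning

InB-suc : ∀ {n z} d → InB n z → InB (suc n) (digitVal d +ᵍ (ρ *ᵍ z))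
InB-suc d (vs , refl) =
  d ∷ vs , cong₂ _+ᵍ_ (*ᵍ-identityʳ (digitVal d)) (digitSum-suc 0 vs)

InB₀-unit : ∀ x y → ∣ x ∣ + ∣ y ∣ ≤ 1 → ¬ BothEven (x , y) → InB 0 (x , y)
InB₀-unit (+ zero)     (+ zero)     _ z-odd = ⊥-elim (z-odd (ℕ.divides 0 refl , ℕ.divides 0 refl))
InB₀-unit (+ zero)     +[1+ 0 ]     _ _     = dU ui ∷ [] , refl
InB₀-unit (+ zero)     -[1+ 0 ]     _ _     = dU umi ∷ [] , refl
InB₀-unit +[1+ 0 ]     (+ zero)     _ _     = dU u1 ∷ [] , refl
InB₀-unit -[1+ 0 ]     (+ zero)     _ _     = dU um1 ∷ [] , refl
InB₀-unit +[1+ suc _ ] _            (s≤s ())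
InB₀-unit -[1+ suc _ ] _            (s≤s ())
InB₀-unit (+ zero)     +[1+ suc _ ] (s≤s ())
InB₀-unit (+ zero)     -[1+ suc _ ] (s≤s ())
InB₀-unit +[1+ 0 ]     +[1+ _ ]     (s≤s ())
InB₀-unit +[1+ 0 ]     -[1+ _ ]     (s≤s ())
InB₀-unit -[1+ 0 ]     +[1+ _ ]     (s≤s ())
InB₀-unit -[1+ 0 ]     -[1+ _ ]     (s≤s ())

odd-m+2≤2n⇒m+3≤2n : ∀ {m n} → ¬ 2 ℕ.∣ m → m + 2 ≤ 2 * n → m + 3 ≤ 2 * n
odd-m+2≤2n⇒m+3≤2n {m} {n} m-odd m+2≤2n =
  subst (_≤ 2 * n) (sym (ℕ.+-suc m 2)) (ℕ.≤∧≢⇒< m+2≤2n m+2≢2n)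
  where
  m+2≢2n : m + 2 ≢ 2 * n
  m+2≢2n eq =
    m-odd (ℕ.∣m+n∣m⇒∣n (ℕ.divides n (trans (ℕ.+-comm 2 m) (trans eq (ℕ.*-comm 2 n)))) ℕ.∣-refl)

2m+3≤2n⇒m+2≤n : ∀ {m n} → 2 * m + 3 ≤ 2 * n → m + 2 ≤ n
2m+3≤2n⇒m+2≤n {m} {n} le =
  subst (_≤ n) (sym (ℕ.+-suc m 1))
    (ℕ.*-cancelˡ-< 2 (m + 1) n (subst (_≤ 2 * n) (2k+3≡1+2[k+1] m) le))
  where
  2k+3≡1+2[k+1] : ∀ k → 2 * k + 3 ≡ suc (2 * (k + 1))
  2k+3≡1+2[k+1] = solve-∀

-- Oct_n is Octagon (w n) (w (suc n)): the paper's bounds w_n − 2 and w_{n+1} − 3, kept in ℕ.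
data Octagon (r s : ℕ) : ℤ[i] → Set where
  octagon : ∀ {x y} → ∣ x ∣ + 2 ≤ r → ∣ y ∣ + 2 ≤ r → ∣ x ∣ + ∣ y ∣ + 3 ≤ s → Octagon r s (x , y)

Octagon-swap : ∀ {r s x y} → Octagon r s (x , y) → Octagon r s (y , x)
Octagon-swap {s = s} {x} {y} (octagon x≤ y≤ x+y≤) =
  octagon y≤ x≤ (subst (λ k → k + 3 ≤ s) (ℕ.+-comm ∣ x ∣ ∣ y ∣) x+y≤)

InOct⇒Octagon : ∀ n z → InOct n z → Octagon (w n) (w (suc n)) z
InOct⇒Octagon n (x , y) (x≤ , y≤ , x+y≤) =
  octagon (+i≤+j-+k⇒i+k≤j x≤) (+i≤+j-+k⇒i+k≤j y≤) (+i≤+j-+k⇒i+k≤j x+y≤)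

Octagon⇒InOct : ∀ n z → Octagon (w n) (w (suc n)) z → InOct n z
Octagon⇒InOct n (x , y) (octagon x≤ y≤ x+y≤) =
  i+k≤j⇒+i≤+j-+k x≤ , i+k≤j⇒+i≤+j-+k y≤ , i+k≤j⇒+i≤+j-+k x+y≤

Octagon-shrink-im : ∀ {H W x y q} → 2 ≤ H → H < W → Octagon (2 * H) (2 * W) (x , y) →
                    ∣ q ∣ ≤ ∣ y ∣ ⊎ ∣ q ∣ ≤ 1 → Octagon (2 * H) (2 * W) (x , q)
Octagon-shrink-im {x = x} _ _ (octagon x≤ y≤ x+y≤) (inj₁ q≤y) =
  octagon x≤ (ℕ.≤-trans (ℕ.+-monoˡ-≤ 2 q≤y) y≤)
             (ℕ.≤-trans (ℕ.+-monoˡ-≤ 3 (ℕ.+-monoʳ-≤ ∣ x ∣ q≤y)) x+y≤)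
-- Stepping off the axis (y = 0, |q| = 1) costs one unit of the ℓ¹ bound, paid for by H < W.
Octagon-shrink-im {H} {W} {x} {q = q} 2≤H H<W (octagon x≤ _ _) (inj₂ q≤1) = octagon x≤ q≤ x+q≤
  where
  open ℕ.≤-Reasoning
  q≤ : ∣ q ∣ + 2 ≤ 2 * H
  q≤ = ℕ.≤-trans (ℕ.+-monoˡ-≤ 2 q≤1) (ℕ.≤-trans (ℕ.n≤1+n 3) (ℕ.*-monoʳ-≤ 2 2≤H))
  a+1+3≡a+2+2 : ∀ a → a + 1 + 3 ≡ a + 2 + 2
  a+1+3≡a+2+2 = solve-∀
  2a+2≡2[1+a] : ∀ a → 2 * a + 2 ≡ 2 * suc a
  2a+2≡2[1+a] = solve-∀
  x+q≤ : ∣ x ∣ + ∣ q ∣ + 3 ≤ 2 * W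
  x+q≤ = begin
    ∣ x ∣ + ∣ q ∣ + 3  ≤⟨ ℕ.+-monoˡ-≤ 3 (ℕ.+-monoʳ-≤ ∣ x ∣ q≤1) ⟩
    ∣ x ∣ + 1 + 3      ≡⟨ a+1+3≡a+2+2 ∣ x ∣ ⟩
    ∣ x ∣ + 2 + 2      ≤⟨ ℕ.+-monoˡ-≤ 2 x≤ ⟩
    2 * H + 2          ≡⟨ 2a+2≡2[1+a] H ⟩
    2 * suc H          ≤⟨ ℕ.*-monoʳ-≤ 2 H<W ⟩
    2 * W              ∎

OddRemainder : ℕ → ℕ → ℤ[i] → Set
OddRemainder H W z = ∃ λ d → ∃₂ λ p q →
  z -ᵍ digitVal d ≡ (p , q) × Odd p × Odd q × Octagon (2 * H) (2 * W) (p , q)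

oddRemainder-odd-even : ∀ {H W x y} → 2 ≤ H → H < W → Odd x → + 2 ∣ y →
                        Octagon (2 * H) (2 * W) (x , y) → OddRemainder H W (x , y)
oddRemainder-odd-even {x = x} {y} 2≤H H<W x-odd 2∣y oct with ℤ.≤-total (+ 0) y
... | inj₁ 0≤y = dU ui , x , y ℤ.- + 1 , cong (_, y ℤ.- + 1) (ℤ.+-identityʳ x) ,
                 x-odd , even+odd {y} { -[1+ 0 ]} 2∣y odd-1 ,
                 Octagon-shrink-im 2≤H H<W oct (0≤i⇒∣i-1∣≤∣i∣⊎∣i-1∣≤1 0≤y)
... | inj₂ y≤0 = dU umi , x , y ℤ.+ + 1 , cong (_, y ℤ.+ + 1) (ℤ.+-identityʳ x) ,
                 x-odd , even+odd {y} {+ 1} 2∣y odd-1 ,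
                 Octagon-shrink-im 2≤H H<W oct (i≤0⇒∣i+1∣≤∣i∣⊎∣i+1∣≤1 y≤0)

oddRemainder-even-odd : ∀ {H W x y} → 2 ≤ H → H < W → + 2 ∣ x → Odd y →
                        Octagon (2 * H) (2 * W) (x , y) → OddRemainder H W (x , y)
oddRemainder-even-odd {x = x} {y} 2≤H H<W 2∣x y-odd oct with ℤ.≤-total (+ 0) x
... | inj₁ 0≤x = dU u1 , x ℤ.- + 1 , y , cong (x ℤ.- + 1 ,_) (ℤ.+-identityʳ y) ,
                 even+odd {x} { -[1+ 0 ]} 2∣x odd-1 , y-odd ,
                 Octagon-swap (Octagon-shrink-im 2≤H H<W (Octagon-swap oct)
                                                 (0≤i⇒∣i-1∣≤∣i∣⊎∣i-1∣≤1 0≤x))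
... | inj₂ x≤0 = dU um1 , x ℤ.+ + 1 , y , cong (x ℤ.+ + 1 ,_) (ℤ.+-identityʳ y) ,
                 even+odd {x} {+ 1} 2∣x odd-1 , y-odd ,
                 Octagon-swap (Octagon-shrink-im 2≤H H<W (Octagon-swap oct)
                                                 (i≤0⇒∣i+1∣≤∣i∣⊎∣i+1∣≤1 x≤0))

oddRemainder : ∀ {H W z} → 2 ≤ H → H < W → ¬ BothEven z →
               Octagon (2 * H) (2 * W) z → OddRemainder H W z
oddRemainder {z = x , y} 2≤H H<W z-odd oct with 2 ℕ.∣? ∣ x ∣ | 2 ℕ.∣? ∣ y ∣
... | yes 2∣x | yes 2∣y = ⊥-elim (z-odd (2∣x , 2∣y))
... | no x-odd | no y-odd =
  d0 , x , y , cong₂ _,_ (ℤ.+-identityʳ x) (ℤ.+-identityʳ y) , x-odd , y-odd , oct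
... | no x-odd | yes 2∣y = oddRemainder-odd-even 2≤H H<W x-odd 2∣y oct
... | yes 2∣x | no y-odd = oddRemainder-even-odd 2≤H H<W 2∣x y-odd oct

halves-in-Octagon : ∀ {H W} a b → Odd (a ℤ.- b) → Odd (a ℤ.+ b) →
                    Octagon (2 * H) (2 * W) (a ℤ.- b , a ℤ.+ b) → Octagon W (2 * H) (a , b)
halves-in-Octagon {H} a b a-b-odd a+b-odd (octagon a-b≤ a+b≤ sum≤) = octagon
  (2m+3≤2n⇒m+2≤n (ℕ.≤-trans (ℕ.+-monoˡ-≤ 3 (2∣i∣≤∣i-j∣+∣i+j∣ a b)) sum≤))
  (2m+3≤2n⇒m+2≤n (ℕ.≤-trans (ℕ.+-monoˡ-≤ 3 (2∣j∣≤∣i-j∣+∣i+j∣ a b)) sum≤))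
  (∣a∣+∣b∣+3≤2H (∣i∣+∣j∣≡∣i-j∣⊎∣i∣+∣j∣≡∣i+j∣ a b))
  where
  ∣a∣+∣b∣+3≤2H : ∣ a ∣ + ∣ b ∣ ≡ ∣ a ℤ.- b ∣ ⊎ ∣ a ∣ + ∣ b ∣ ≡ ∣ a ℤ.+ b ∣ →
                 ∣ a ∣ + ∣ b ∣ + 3 ≤ 2 * H
  ∣a∣+∣b∣+3≤2H (inj₁ eq) = subst (λ k → k + 3 ≤ 2 * H) (sym eq)
                                 (odd-m+2≤2n⇒m+3≤2n {∣ a ℤ.- b ∣} {H} a-b-odd a-b≤)
  ∣a∣+∣b∣+3≤2H (inj₂ eq) = subst (λ k → k + 3 ≤ 2 * H) (sym eq)
                                 (odd-m+2≤2n⇒m+3≤2n {∣ a ℤ.+ b ∣} {H} a+b-odd a+b≤)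

Octagon-digit-step : ∀ {H W z} → 2 ≤ H → H < W → ¬ BothEven z → Octagon (2 * H) (2 * W) z →
                     ∃₂ λ d z′ → z ≡ digitVal d +ᵍ (ρ *ᵍ z′) × Octagon W (2 * H) z′ × ¬ BothEven z′
Octagon-digit-step {H} {W} {z} 2≤H H<W z-odd oct with oddRemainder 2≤H H<W z-odd oct
... | d , p , q , z-d≡pq , p-odd , q-odd , oct′ with odd-halves {p} {q} p-odd q-odd
... | a , b , refl , refl =
  d , (a , b) , z≡ , halves-in-Octagon {H} {W} a b p-odd q-odd oct′ ,
  odd-difference⇒¬BothEven {a} {b} p-odd
  where
  open ≡-Reasoning
  z≡ : z ≡ digitVal d +ᵍ (ρ *ᵍ (a , b))
  z≡ = begin
    z                                      ≡⟨ x≡y+ᵍ[x-ᵍy] z (digitVal d) ⟩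
    digitVal d +ᵍ (z -ᵍ digitVal d)        ≡⟨ cong (digitVal d +ᵍ_) z-d≡pq ⟩
    digitVal d +ᵍ (a ℤ.- b , a ℤ.+ b)      ≡⟨ cong (digitVal d +ᵍ_) (ρ*ᵍ[a,b]≡[a-b,a+b] a b) ⟨
    digitVal d +ᵍ (ρ *ᵍ (a , b))           ∎

w-suc-suc : ∀ k → w (suc (suc k)) ≡ 2 * w k
w-suc-suc k with k ℕ.% 2
... | zero  rewrite m/n≡1+[m∸n]/n {suc (suc k)} {2} (s≤s (s≤s z≤n)) =
  4a+2a≡2[2a+a] (2 ^ (k ℕ./ 2))
  where
  4a+2a≡2[2a+a] : ∀ a → 2 * (2 * a) + 2 * a ≡ 2 * (2 * a + a)
  4a+2a≡2[2a+a] = solve-∀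
... | suc _ rewrite m/n≡1+[m∸n]/n {suc (suc k)} {2} (s≤s (s≤s z≤n)) = refl

halfW : ℕ → ℕ
halfW zero    = 2
halfW (suc n) = w n

w-suc : ∀ n → w (suc n) ≡ 2 * halfW n
w-suc zero    = refl
w-suc (suc n) = w-suc-suc n

w<w-suc : ∀ n → w n < w (suc n)
w<w-suc 0 = ℕ.≤-refl
w<w-suc 1 = ℕ.n≤1+n 5
w<w-suc (suc (suc n)) rewrite w-suc-suc n | w-suc-suc (suc n) = ℕ.*-monoʳ-< 2 (w<w-suc n)

halfW<w : ∀ n → halfW n < w n
halfW<w zero    = ℕ.≤-refl
halfW<w (suc n) = w<w-suc n

2≤halfW : ∀ n → 2 ≤ halfW n
2≤halfW zero    = ℕ.≤-refl
2≤halfW (suc n) = ℕ.≤-trans (2≤halfW n) (ℕ.<⇒≤ (halfW<w n))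

odd-Oct⊆B : ∀ n z → ¬ BothEven z → InOct n z → InB n z
odd-Oct⊆B zero (x , y) z-odd oct with InOct⇒Octagon 0 (x , y) oct
... | octagon _ _ x+y+3≤4 = InB₀-unit x y (ℕ.+-cancelʳ-≤ 3 (∣ x ∣ + ∣ y ∣) 1 x+y+3≤4) z-odd
odd-Oct⊆B (suc n) z z-odd oct with Octagon-digit-step (2≤halfW n) (halfW<w n) z-odd octagon-suc
  where
  octagon-suc : Octagon (2 * halfW n) (2 * w n) z
  octagon-suc =
    subst₂ (λ r s → Octagon r s z) (w-suc n) (w-suc-suc n) (InOct⇒Octagon (suc n) z oct)
... | d , z′ , z≡ , oct′ , z′-odd =
  subst (InB (suc n)) (sym z≡) (InB-suc d (odd-Oct⊆B n z′ z′-odd inOct))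
  where
  inOct : InOct n z′
  inOct = Octagon⇒InOct n z′ (subst (λ s → Octagon (w n) s z′) (sym (w-suc n)) oct′)

mainTheorem14 : (n : ℕ) (a b : ℤ) → ¬ ((+ 2 ∣ a) × (+ 2 ∣ b))
    → (u : Unit) (x y : ℤ) → + 2 ∣ x → + 2 ∣ y
    → (x , y) ∈ InOct n +shift (unitVal u *ᵍ (a , b))
    → (x , y) ∈ InB n +shift (unitVal u *ᵍ (a , b))
mainTheorem14 n a b ab-odd u x y 2∣x 2∣y =
  odd-Oct⊆B n _
    (¬BothEven-translate {x , y} (2∣x , 2∣y) (¬BothEven-unit*ᵍ u {a , b} ab-odd))
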